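{- The maximum-matching size $m(\cdot)$ and the minimum vertex-cover size $VC(\cdot)$, viewed as functions of a graph stream, are both $2$-almost-smooth.
   Context: A graph stream is a sequence of edges on the vertex set $V=[n]$ ($n$ known), with no edge appearing twice; a segment (or stream) $S$ defines the graph on $V$ whose edge set is the set of edges in $S$. $m(S)$ is the maximum number of pairwise vertex-disjoint edges in this graph, and $VC(S)$ is the minimum size of a set $C\subseteq V$ meeting every edge of it. For disjoint consecutive segments $A,B$, $AB$ denotes their concatenation. A function $f$ on streams is $2$-almost-smooth if: (1) $f(A)\ge0$ for all $A$; (2) $f(B)\le f(AB)$ for all disjoint segments $A,B$; (3) $f(A)\le\mathrm{poly}(n)$ for all $A$; (4) for all disjoint segments $A,B,C$, $\frac{f(B)}{f(AB)}\le 2\cdot\frac{f(BC)}{f(ABC)}$ whenever $f(AB)\neq0$ and $f(ABC)\neq0$. -}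

module Defs where

open import Data.Nat using (ℕ; zero; suc; _+_; _*_; _^_; _≤_; _⊔_; _⊓_)
open import Data.Fin using (Fin; toℕ)
import Data.Fin as F
open import Data.Product using (Σ; _×_; _,_; proj₁; proj₂; ∃)
open import Data.Sum using (_⊎_)
open import Data.Bool using (Bool; true; false)
open import Data.List using (List; []; _∷_; _++_; map; foldr; length; filter)
open import Data.Vec using (Vec; []; _∷_)
open import Data.List.Relation.Unary.All using (All; all?)
open import Data.List.Relation.Unary.AllPairs using (AllPairs; allPairs?)
open import Data.List.Relation.Unary.Unique.Propositional using (Unique)
open import Data.Fin.Subset using (Subset; _∈_; ∣_∣)
open import Data.Fin.Subset.Properties using (_∈?_)
open import Relation.Binary.PropositionalEquality using (_≢_)
open import Relation.Nullary using (Dec; ¬_)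
open import Relation.Nullary.Decidable using (_×-dec_; _⊎-dec_; ¬?)
import Data.Fin.Properties as FP

-- An (undirected, loopless) edge on V = Fin n, stored canonically as
-- (u , v) with u < v, so that {u,v} = {v,u} has a single representation.
Edge : ℕ → Set
Edge n = Σ (Fin n × Fin n) (λ p → proj₁ p F.< proj₂ p)

u : ∀ {n} → Edge n → Fin n
u e = proj₁ (proj₁ e)

v : ∀ {n} → Edge n → Fin n
v e = proj₂ (proj₁ e)

Stream : ℕ → Set
Stream n = List (Edge n)

-- "No edge appears twice": the (concatenated) stream has no repeated edge.
-- Segments A, B, C are disjoint consecutive segments iff A ++ B ++ C is Unique.

VertexDisjoint : ∀ {n} → Edge n → Edge n → Set
VertexDisjoint e f =
  (u e ≢ u f) × (u e ≢ v f) × (v e ≢ u f) × (v e ≢ v f)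

vertexDisjoint? : ∀ {n} (e f : Edge n) → Dec (VertexDisjoint e f)
vertexDisjoint? e f =
  ¬? (u e FP.≟ u f) ×-dec ¬? (u e FP.≟ v f) ×-dec
  ¬? (v e FP.≟ u f) ×-dec ¬? (v e FP.≟ v f)

IsMatching : ∀ {n} → List (Edge n) → Set
IsMatching M = AllPairs VertexDisjoint M

-- All subsequences (sub-lists) of a list; for a stream with no repeated
-- edge these are exactly the subsets of its edge set.
sublists : ∀ {a} {A : Set a} → List A → List (List A)
sublists [] = [] ∷ []
sublists (x ∷ xs) = let r = sublists xs in map (x ∷_) r ++ r

maxList : List ℕ → ℕ
maxList = foldr _⊔_ 0

-- m(S): maximum number of pairwise vertex-disjoint edges of the graph of S
-- (the empty matching always exists, so the default 0 is harmless).
m : ∀ {n} → Stream n → ℕ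
m S = maxList (map length (filter (allPairs? vertexDisjoint?) (sublists S)))

allSubsets : (n : ℕ) → List (Subset n)
allSubsets zero = [] ∷ []
allSubsets (suc n) =
  let r = allSubsets n in map (true ∷_) r ++ map (false ∷_) r

Covers : ∀ {n} → Subset n → Stream n → Set
Covers C S = All (λ e → (u e ∈ C) ⊎ (v e ∈ C)) S

covers? : ∀ {n} (C : Subset n) (S : Stream n) → Dec (Covers C S)
covers? C S = all? (λ e → (u e ∈? C) ⊎-dec (v e ∈? C)) S

-- VC(S): minimum size of a vertex cover C ⊆ V = Fin n of the graph of S.
-- (V itself is always a cover, of size n, so the default n is harmless.)
VC : ∀ {n} → Stream n → ℕ
VC {n} S = foldr _⊓_ n (map ∣_∣ (filter (λ C → covers? C S) (allSubsets n)))

-- Values are natural numbers, so (1) f(A) ≥ 0 holds automatically.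
-- (4) f(B)/f(AB) ≤ 2·f(BC)/f(ABC), with f(AB), f(ABC) > 0, is written
-- after multiplying out the (positive) denominators.
AlmostSmooth2 : ((n : ℕ) → Stream n → ℕ) → Set
AlmostSmooth2 f =
  (∀ n (A B : Stream n) → Unique (A ++ B) → f n B ≤ f n (A ++ B))
  × (∃ λ c → ∀ n (A : Stream n) → f n A ≤ c * n ^ c + c)
  × (∀ n (A B C : Stream n) → Unique (A ++ B ++ C) →
       ¬ (f n (A ++ B) ≡ 0) → ¬ (f n (A ++ B ++ C) ≡ 0) →
       f n B * f n (A ++ B ++ C) ≤ 2 * f n (B ++ C) * f n (A ++ B))
  where open import Relation.Binary.PropositionalEquality using (_≡_)

-- Both m and VC are monotone under taking sub-streams and subadditive under
-- concatenation: a matching of AB splits into matchings of A and of B, and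
-- the union of covers of A and of B covers AB.  For such an f,
-- f(ABC) ≤ f(A) + f(BC) ≤ f(AB) + f(BC), and multiplying by
-- f(B) ≤ min (f(AB), f(BC)) gives f(B)·f(ABC) ≤ 2·f(BC)·f(AB).
-- Both are also at most n: a matching has distinct left endpoints.
module Submission where

open import Defs
open import Data.Nat using (ℕ; _+_; _*_; _^_; _≤_; _⊔_; _⊓_; z≤n; s≤s)
open import Data.Nat.Properties
open import Data.Fin using (Fin)
import Data.Fin as F
open import Data.Fin.Properties using (pigeonhole)
open import Data.Fin.Subset using (Subset; _∪_; ⊤; ∣_∣)
open import Data.Fin.Subset.Properties using (∈⊤; ∣⊤∣≡n; p⊆p∪q; q⊆p∪q)
open import Data.Product using (_×_; _,_; proj₁; proj₂; ∃; ∃₂)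
open import Data.Sum using (inj₁; inj₂)
open import Data.Bool using (true; false)
open import Data.Vec using ([]; _∷_)
open import Data.List using (List; []; _∷_; _++_; map; foldr; filter; length; lookup)
open import Data.List.Properties using (length-++)
open import Data.List.Membership.Propositional using (_∈_)
open import Data.List.Membership.Propositional.Properties
  using (∈-++⁺ˡ; ∈-++⁺ʳ; ∈-++⁻; ∈-map⁺; ∈-map⁻; ∈-filter⁺; ∈-filter⁻; ∈-lookup; foldr-selective)
open import Data.List.Relation.Unary.Any using (here; there)
import Data.List.Relation.Unary.All as All
import Data.List.Relation.Unary.All.Properties as All
open import Data.List.Relation.Unary.AllPairs using (AllPairs; []; _∷_; allPairs?)
import Data.List.Relation.Unary.AllPairs as AllPairs
open import Data.List.Relation.Binary.Sublist.Propositional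
  using ([]; _∷ʳ_; _∷_; ⊆-refl; ⊆-trans) renaming (_⊆_ to _⊑_)
open import Data.List.Relation.Binary.Sublist.Propositional.Properties
  using (All-resp-⊆; ++⁺ˡ; ++⁺ʳ; []⊆-universal)
open import Relation.Binary.PropositionalEquality
open import Relation.Nullary using (yes; no)
open import Data.Empty using (⊥-elim)

Monotone : ((n : ℕ) → Stream n → ℕ) → Set
Monotone f = ∀ {n} {S T : Stream n} → S ⊑ T → f n S ≤ f n T

Subadditive : ((n : ℕ) → Stream n → ℕ) → Set
Subadditive f = ∀ {n} (S T : Stream n) → f n (S ++ T) ≤ f n S + f n T

BoundedByVertexCount : ((n : ℕ) → Stream n → ℕ) → Set
BoundedByVertexCount f = ∀ {n} (S : Stream n) → f n S ≤ n

smoothness-inequality : ∀ {b ab bc abc} →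
  abc ≤ ab + bc → b ≤ ab → b ≤ bc → b * abc ≤ 2 * bc * ab
smoothness-inequality {b} {ab} {bc} {abc} abc≤ b≤ab b≤bc = begin
  b * abc            ≤⟨ *-monoʳ-≤ b abc≤ ⟩
  b * (ab + bc)      ≡⟨ *-distribˡ-+ b ab bc ⟩
  b * ab + b * bc    ≤⟨ +-mono-≤ (*-monoˡ-≤ ab b≤bc) (*-monoˡ-≤ bc b≤ab) ⟩
  bc * ab + ab * bc  ≡⟨ cong (bc * ab +_) (*-comm ab bc) ⟩
  bc * ab + bc * ab  ≡⟨ cong (bc * ab +_) (sym (+-identityʳ (bc * ab))) ⟩
  2 * (bc * ab)      ≡⟨ *-assoc 2 bc ab ⟨
  2 * bc * ab        ∎
  where open ≤-Reasoning

n≤1*n^1+1 : ∀ n → n ≤ 1 * n ^ 1 + 1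
n≤1*n^1+1 n = begin
  n              ≡⟨ ^-identityʳ n ⟨
  n ^ 1          ≡⟨ *-identityˡ (n ^ 1) ⟨
  1 * n ^ 1      ≤⟨ m≤m+n (1 * n ^ 1) 1 ⟩
  1 * n ^ 1 + 1  ∎
  where open ≤-Reasoning

monotone-subadditive⇒almostSmooth2 : ∀ {f} →
  Monotone f → Subadditive f → BoundedByVertexCount f → AlmostSmooth2 f
monotone-subadditive⇒almostSmooth2 mono sub bound =
    (λ n A B _ → mono (++⁺ˡ A ⊆-refl))
  , (1 , λ n A → ≤-trans (bound A) (n≤1*n^1+1 n))
  , λ n A B C _ _ _ → smoothness-inequality
      (≤-trans (sub A (B ++ C)) (+-monoˡ-≤ _ (mono (++⁺ʳ B ⊆-refl))))
      (mono (++⁺ˡ A ⊆-refl))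
      (mono (++⁺ʳ C ⊆-refl))

≤-foldr-⊔ : ∀ {x} d xs → x ∈ xs → x ≤ foldr _⊔_ d xs
≤-foldr-⊔ d (y ∷ xs) (here refl) = m≤m⊔n y _
≤-foldr-⊔ d (y ∷ xs) (there x∈xs) = ≤-trans (≤-foldr-⊔ d xs x∈xs) (m≤n⊔m y _)

foldr-⊓-≤ : ∀ {x} d xs → x ∈ xs → foldr _⊓_ d xs ≤ x
foldr-⊓-≤ d (y ∷ xs) (here refl) = m⊓n≤m y _
foldr-⊓-≤ d (y ∷ xs) (there x∈xs) = ≤-trans (m⊓n≤n y _) (foldr-⊓-≤ d xs x∈xs)

module _ {a} {A : Set a} where

  ∈-sublists⁺ : ∀ {M S : List A} → M ⊑ S → M ∈ sublists S
  ∈-sublists⁺ [] = here refl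
  ∈-sublists⁺ {S = x ∷ S} (_ ∷ʳ M⊑S) = ∈-++⁺ʳ (map (x ∷_) (sublists S)) (∈-sublists⁺ M⊑S)
  ∈-sublists⁺ (refl ∷ M⊑S) = ∈-++⁺ˡ (∈-map⁺ _ (∈-sublists⁺ M⊑S))

  ∈-sublists⁻ : ∀ {M : List A} S → M ∈ sublists S → M ⊑ S
  ∈-sublists⁻ [] (here refl) = []
  ∈-sublists⁻ (x ∷ S) M∈ with ∈-++⁻ (map (x ∷_) (sublists S)) M∈
  ... | inj₂ M∈S = x ∷ʳ ∈-sublists⁻ S M∈S
  ... | inj₁ M∈xS with ∈-map⁻ (x ∷_) M∈xS
  ...   | M′ , M′∈S , refl = refl ∷ ∈-sublists⁻ S M′∈S

  ⊑-++⁻ : ∀ {M : List A} S T → M ⊑ S ++ T →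
    ∃₂ λ M₁ M₂ → M ≡ M₁ ++ M₂ × M₁ ⊑ S × M₂ ⊑ T
  ⊑-++⁻ [] T M⊑T = [] , _ , refl , [] , M⊑T
  ⊑-++⁻ (x ∷ S) T (_ ∷ʳ M⊑) with ⊑-++⁻ S T M⊑
  ... | M₁ , M₂ , refl , M₁⊑S , M₂⊑T = M₁ , M₂ , refl , x ∷ʳ M₁⊑S , M₂⊑T
  ⊑-++⁻ (x ∷ S) T (refl ∷ M⊑) with ⊑-++⁻ S T M⊑
  ... | M₁ , M₂ , refl , M₁⊑S , M₂⊑T = x ∷ M₁ , M₂ , refl , refl ∷ M₁⊑S , M₂⊑T

  AllPairs-resp-⊑ : ∀ {r} {R : A → A → Set r} {M N : List A} →
    M ⊑ N → AllPairs R N → AllPairs R M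
  AllPairs-resp-⊑ [] [] = []
  AllPairs-resp-⊑ (_ ∷ʳ M⊑N) (_ ∷ pairs) = AllPairs-resp-⊑ M⊑N pairs
  AllPairs-resp-⊑ (refl ∷ M⊑N) (px ∷ pairs) = All-resp-⊆ M⊑N px ∷ AllPairs-resp-⊑ M⊑N pairs

  AllPairs-lookup : ∀ {r} {R : A → A → Set r} {xs : List A} → AllPairs R xs →
    ∀ {i j} → i F.< j → R (lookup xs i) (lookup xs j)
  AllPairs-lookup (px ∷ _) {F.zero} {F.suc j} _ = All.lookup px (∈-lookup j)
  AllPairs-lookup (_ ∷ pairs) {F.suc i} {F.suc j} (s≤s i<j) = AllPairs-lookup pairs i<j

  pairwiseDistinctImage⇒length≤ : ∀ {n} (g : A → Fin n) {xs : List A} →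
    AllPairs (λ x y → g x ≢ g y) xs → length xs ≤ n
  pairwiseDistinctImage⇒length≤ {n} g {xs} distinct with length xs ≤? n
  ... | yes ≤n = ≤n
  ... | no ≰n with pigeonhole (≰⇒> ≰n) (λ i → g (lookup xs i))
  ...   | i , j , i<j , gᵢ≡gⱼ = ⊥-elim (AllPairs-lookup distinct i<j gᵢ≡gⱼ)

module _ {n : ℕ} where

  length≤m : ∀ {M S : Stream n} → M ⊑ S → IsMatching M → length M ≤ m S
  length≤m M⊑S matching =
    ≤-foldr-⊔ 0 _ (∈-map⁺ length
      (∈-filter⁺ (allPairs? vertexDisjoint?) (∈-sublists⁺ M⊑S) matching))

  m-attained : ∀ (S : Stream n) → ∃ λ M → M ⊑ S × IsMatching M × length M ≡ m S
  m-attained S with foldr-selective ⊔-sel 0 (map length (filter (allPairs? vertexDisjoint?) (sublists S)))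
  ... | inj₁ m≡0 = [] , []⊆-universal S , [] , sym m≡0
  ... | inj₂ m∈ with ∈-map⁻ length m∈
  ...   | M , M∈ , m≡ with ∈-filter⁻ (allPairs? vertexDisjoint?) M∈
  ...     | M∈S , matching = M , ∈-sublists⁻ S M∈S , matching , sym m≡

  matching-length≤n : ∀ {M : Stream n} → IsMatching M → length M ≤ n
  matching-length≤n matching =
    pairwiseDistinctImage⇒length≤ u (AllPairs.map proj₁ matching)

m-monotone : Monotone (λ n → m {n})
m-monotone {S = S} S⊑T with m-attained S
... | M , M⊑S , matching , M≡ = subst (_≤ _) M≡ (length≤m (⊆-trans M⊑S S⊑T) matching)

m-subadditive : Subadditive (λ n → m {n})
m-subadditive S T with m-attained (S ++ T)
... | M , M⊑ST , matching , M≡ with ⊑-++⁻ S T M⊑ST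
...   | M₁ , M₂ , refl , M₁⊑S , M₂⊑T = begin
  m (S ++ T)            ≡⟨ M≡ ⟨
  length (M₁ ++ M₂)     ≡⟨ length-++ M₁ ⟩
  length M₁ + length M₂ ≤⟨ +-mono-≤ (length≤m M₁⊑S (AllPairs-resp-⊑ (++⁺ʳ M₂ ⊆-refl) matching))
                                    (length≤m M₂⊑T (AllPairs-resp-⊑ (++⁺ˡ M₁ ⊆-refl) matching)) ⟩
  m S + m T             ∎
  where open ≤-Reasoning

m-bounded : BoundedByVertexCount (λ n → m {n})
m-bounded S with m-attained S
... | M , _ , matching , M≡ = subst (_≤ _) M≡ (matching-length≤n matching)

∈-allSubsets : ∀ {n} (C : Subset n) → C ∈ allSubsets n
∈-allSubsets [] = here refl
∈-allSubsets {ℕ.suc n} (true ∷ C) = ∈-++⁺ˡ (∈-map⁺ (true ∷_) (∈-allSubsets C))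
∈-allSubsets {ℕ.suc n} (false ∷ C) =
  ∈-++⁺ʳ (map (true ∷_) (allSubsets n)) (∈-map⁺ (false ∷_) (∈-allSubsets C))

∣p∪q∣≤∣p∣+∣q∣ : ∀ {n} (p q : Subset n) → ∣ p ∪ q ∣ ≤ ∣ p ∣ + ∣ q ∣
∣p∪q∣≤∣p∣+∣q∣ [] [] = z≤n
∣p∪q∣≤∣p∣+∣q∣ (true ∷ p) (true ∷ q) = s≤s (≤-trans (∣p∪q∣≤∣p∣+∣q∣ p q) (+-monoʳ-≤ ∣ p ∣ (n≤1+n ∣ q ∣)))
∣p∪q∣≤∣p∣+∣q∣ (true ∷ p) (false ∷ q) = s≤s (∣p∪q∣≤∣p∣+∣q∣ p q)
∣p∪q∣≤∣p∣+∣q∣ (false ∷ p) (true ∷ q) = ≤-trans (s≤s (∣p∪q∣≤∣p∣+∣q∣ p q)) (≤-reflexive (sym (+-suc ∣ p ∣ ∣ q ∣)))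
∣p∪q∣≤∣p∣+∣q∣ (false ∷ p) (false ∷ q) = ∣p∪q∣≤∣p∣+∣q∣ p q

module _ {n : ℕ} where

  ⊤-covers : (S : Stream n) → Covers ⊤ S
  ⊤-covers S = All.tabulate (λ _ → inj₁ ∈⊤)

  ∪-coversˡ : ∀ {C : Subset n} D {S} → Covers C S → Covers (C ∪ D) S
  ∪-coversˡ D = All.map λ { (inj₁ x∈C) → inj₁ (p⊆p∪q D x∈C) ; (inj₂ y∈C) → inj₂ (p⊆p∪q D y∈C) }

  ∪-coversʳ : ∀ C {D : Subset n} {S} → Covers D S → Covers (C ∪ D) S
  ∪-coversʳ C = All.map λ { (inj₁ x∈D) → inj₁ (q⊆p∪q C _ x∈D) ; (inj₂ y∈D) → inj₂ (q⊆p∪q C _ y∈D) }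

  VC≤ : ∀ {C : Subset n} {S} → Covers C S → VC S ≤ ∣ C ∣
  VC≤ {C} {S} covers =
    foldr-⊓-≤ n _ (∈-map⁺ ∣_∣ (∈-filter⁺ (λ C → covers? C S) (∈-allSubsets C) covers))

  VC-attained : ∀ (S : Stream n) → ∃ λ C → Covers C S × ∣ C ∣ ≡ VC S
  VC-attained S with foldr-selective ⊓-sel n (map ∣_∣ (filter (λ C → covers? C S) (allSubsets n)))
  ... | inj₁ VC≡n = ⊤ , ⊤-covers S , trans (∣⊤∣≡n n) (sym VC≡n)
  ... | inj₂ VC∈ with ∈-map⁻ ∣_∣ VC∈
  ...   | C , C∈ , VC≡ = C , proj₂ (∈-filter⁻ (λ C → covers? C S) {xs = allSubsets n} C∈) , sym VC≡

VC-monotone : Monotone (λ n → VC {n})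
VC-monotone {T = T} S⊑T with VC-attained T
... | C , covers , C≡ = subst (_ ≤_) C≡ (VC≤ (All-resp-⊆ S⊑T covers))

VC-subadditive : Subadditive (λ n → VC {n})
VC-subadditive S T with VC-attained S | VC-attained T
... | C , coversS , C≡ | D , coversT , D≡ = subst₂ (λ c d → _ ≤ c + d) C≡ D≡
  (≤-trans (VC≤ (All.++⁺ (∪-coversˡ D coversS) (∪-coversʳ C coversT))) (∣p∪q∣≤∣p∣+∣q∣ C D))

VC-bounded : BoundedByVertexCount (λ n → VC {n})
VC-bounded {n} S = ≤-trans (VC≤ (⊤-covers S)) (≤-reflexive (∣⊤∣≡n n))

corollary2p5 : AlmostSmooth2 (λ n S → m {n} S) × AlmostSmooth2 (λ n S → VC {n} S)
corollary2p5 = monotone-subadditive⇒almostSmooth2 m-monotone m-subadditive m-bounded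
             , monotone-subadditive⇒almostSmooth2 VC-monotone VC-subadditive VC-bounded
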